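{- Bounded variable elimination applied to a non-concrete feature is sampling-safe. That is, let $\varphi$ be a CNF formula with concrete feature set $\mathcal{C}$, let $y\notin\mathcal{C}$ be a feature, and let $\psi$ be obtained from $\varphi$ by eliminating $y$ (adding all non-tautological resolvents on $y$ of a clause containing $y$ with a clause containing $\overline{y}$, then deleting all clauses containing $y$ or $\overline{y}$ and the variable $y$), with the same concrete feature set $\mathcal{C}$. Then for every sample of $\varphi$ with pairwise coverage there is a sample of $\psi$ with pairwise coverage of the same size, and for every sample of $\psi$ with pairwise coverage there is a sample of $\varphi$ with pairwise coverage of the same size.
   Context: A CNF formula $\varphi$ over Boolean features $\mathcal{F}$ with concrete features $\mathcal{C}\subseteq\mathcal{F}$. Configurations are satisfying assignments, viewed as sets of literals. A pairwise interaction is a set of 2 literals of concrete features; it is feasible if contained in some satisfying assignment. A sample (set of satisfying assignments) has pairwise coverage if every feasible pairwise interaction is contained in some member; additionally, by convention, if the formula is satisfiable the sample must contain at least one configuration, and if there is exactly one concrete feature $x$ and both $x$ and $\overline{x}$ occur in satisfying assignments, the sample must contain a configuration with $x$ and one with $\overline{x}$. -}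

module Defs where

open import Data.Nat using (ℕ; suc)
open import Data.Bool using (Bool; true; false; not; if_then_else_)
import Data.Bool.Properties as BoolP
open import Data.Fin using (Fin; punchOut)
import Data.Fin.Properties as FinP
open import Data.Fin.Subset using (Subset; _∈_; ∣_∣)
open import Data.Vec using (Vec; lookup)
open import Data.List using (List; []; _∷_; _++_; map; filterᵇ; mapMaybe; concatMap)
open import Data.Bool.ListAction using (any)
open import Data.List.Relation.Unary.All using (All)
open import Data.List.Relation.Unary.Any using (Any)
open import Data.List.Membership.Propositional renaming (_∈_ to _∈ₗ_)
open import Data.Maybe using (Maybe; just; nothing)
open import Data.Product using (_×_; _,_; proj₁; proj₂; ∃; ∃-syntax)
open import Data.Product.Properties using (≡-dec)
open import Relation.Binary.PropositionalEquality using (_≡_; _≢_)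
open import Relation.Binary.Definitions using (DecidableEquality)
open import Relation.Nullary.Decidable using (⌊_⌋; yes; no)

-- Syntax: features of a formula over m variables are Fin m.
-- A literal (x , true) is x, (x , false) is the negation of x.

Lit : ℕ → Set
Lit m = Fin m × Bool

Clause : ℕ → Set
Clause m = List (Lit m)

CNF : ℕ → Set
CNF m = List (Clause m)

_≟L_ : ∀ {m} → DecidableEquality (Lit m)
_≟L_ = ≡-dec FinP._≟_ BoolP._≟_

neg : ∀ {m} → Lit m → Lit m
neg (x , b) = (x , not b)

memb : ∀ {m} → Lit m → Clause m → Bool
memb l c = any (λ l' → ⌊ l ≟L l' ⌋) c

taut : ∀ {m} → Clause m → Bool
taut c = any (λ l → memb (neg l) c) c

mentions : ∀ {m} → Fin m → Clause m → Bool
mentions y c = any (λ l → ⌊ proj₁ l FinP.≟ y ⌋) c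

resolve : ∀ {m} → Fin m → Clause m → Clause m → Clause m
resolve y c d = filterᵇ (λ l → not ⌊ l ≟L (y , true) ⌋) c
             ++ filterᵇ (λ l → not ⌊ l ≟L (y , false) ⌋) d

resolvents : ∀ {m} → Fin m → CNF m → CNF m
resolvents y φ =
  concatMap (λ c → if memb (y , true) c
                   then concatMap (λ d → if memb (y , false) d then resolve y c d ∷ [] else []) φ
                   else []) φ

-- deleting the variable y: rename the remaining variables Fin (suc n) \ {y} to Fin n
-- (via punchOut). Literals on y itself are dropped; after the deletion step
-- no clause mentions y, so this never happens.
dropLit : ∀ {n} → Fin (suc n) → Lit (suc n) → Maybe (Lit n)
dropLit y (x , b) with y FinP.≟ x
... | yes _  = nothing
... | no y≢x = just (punchOut y≢x , b)

eliminate : ∀ {n} → Fin (suc n) → CNF (suc n) → CNF n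
eliminate y φ =
  map (mapMaybe (dropLit y))
      (filterᵇ (λ c → not (mentions y c))
               (φ ++ filterᵇ (λ r → not (taut r)) (resolvents y φ)))

-- Semantics: an assignment (configuration) over Fin m, viewed as the set of
-- literals it makes true.

Assignment : ℕ → Set
Assignment m = Vec Bool m

_∋ˡ_ : ∀ {m} → Assignment m → Lit m → Set
a ∋ˡ (x , b) = lookup a x ≡ b

Sat : ∀ {m} → CNF m → Assignment m → Set
Sat φ a = All (λ c → Any (λ l → a ∋ˡ l) c) φ

Satisfiable : ∀ {m} → CNF m → Set
Satisfiable φ = ∃[ a ] Sat φ a

-- a sample: a (finite) collection of satisfying assignments; its size is its length
IsSample : ∀ {m} → CNF m → List (Assignment m) → Set
IsSample φ S = All (Sat φ) S

Concrete : ∀ {m} → Subset m → Lit m → Set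
Concrete C l = proj₁ l ∈ C

Feasible₂ : ∀ {m} → CNF m → Lit m → Lit m → Set
Feasible₂ φ l₁ l₂ = ∃[ a ] (Sat φ a × a ∋ˡ l₁ × a ∋ˡ l₂)

Covered₂ : ∀ {m} → List (Assignment m) → Lit m → Lit m → Set
Covered₂ S l₁ l₂ = ∃[ a ] (a ∈ₗ S × a ∋ˡ l₁ × a ∋ˡ l₂)

PairwiseCoverage : ∀ {m} → Subset m → CNF m → List (Assignment m) → Set
PairwiseCoverage C φ S =
    (∀ l₁ l₂ → Concrete C l₁ → Concrete C l₂ → l₁ ≢ l₂ →
       Feasible₂ φ l₁ l₂ → Covered₂ S l₁ l₂)
  × (Satisfiable φ → S ≢ [])
  × (∣ C ∣ ≡ 1 → ∀ x → x ∈ C →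
       (∃[ a ] (Sat φ a × a ∋ˡ (x , true))) →
       (∃[ a ] (Sat φ a × a ∋ˡ (x , false))) →
       (∃[ a ] (a ∈ₗ S × a ∋ˡ (x , true))) × (∃[ a ] (a ∈ₗ S × a ∋ˡ (x , false))))

-- Eliminating y maps models of φ to models of ψ = eliminate y φ by forgetting y,
-- and every model b of ψ extends to a model of φ: if neither value of y worked,
-- some clause c (containing y) would fail for y = false and some clause d
-- (containing ¬y) for y = true, and their resolvent on y, which either is a
-- tautology or survives into ψ, would fail under b, which is impossible.
-- Both translations leave the values of the concrete features untouched, since
-- y is not concrete, so they carry pairwise-covering samples to pairwise-covering
-- samples of the same size in either direction.
module Submission where

open import Defs
open import Data.Nat using (ℕ; suc)
open import Data.Fin using (Fin; zero; suc; punchIn; punchOut) renaming (_≟_ to _≟ᶠ_)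
open import Data.Fin.Properties
  using (punchIn-punchOut; punchOut-punchIn; punchInᵢ≢i; punchIn-injective; punchOut-injective)
open import Data.Fin.Subset using (Subset; _∈_; _∉_; ∣_∣)
open import Data.Vec using (Vec; lookup; insertAt; removeAt)
import Data.Vec as Vec
open import Data.Vec.Properties
  using (insertAt-lookup; insertAt-punchIn; removeAt-punchOut; []=⇒lookup; lookup⇒[]=)
open import Data.List using (List; []; _∷_; _++_; length; map; filterᵇ; mapMaybe; concatMap)
open import Data.List.Properties using (length-map)
open import Data.List.Relation.Unary.Any as Any using (Any; here; there)
open import Data.List.Relation.Unary.Any.Properties using (any⁺; any⁻)
open import Data.List.Relation.Unary.All as All using (All; _∷_)
open import Data.List.Relation.Unary.All.Properties using (map⁺; ¬Any⇒All¬; All¬⇒¬Any; ¬All⇒Any¬)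
open import Data.List.Membership.Propositional using (find; lose) renaming (_∈_ to _∈ₗ_)
open import Data.List.Membership.Propositional.Properties
  using (∈-map⁺; ∈-map⁻; ∈-++⁺ˡ; ∈-++⁺ʳ; ∈-++⁻; ∈-filter⁺; ∈-filter⁻; ∈-concatMap⁺; ∈-concatMap⁻)
open import Data.Bool using (Bool; true; false; not; if_then_else_; T; T?)
import Data.Bool.Properties as Bool
open import Data.Product using (_×_; _,_; proj₁; proj₂; ∃-syntax; ∃₂)
open import Data.Sum using (_⊎_; inj₁; inj₂)
open import Data.Empty using (⊥)
open import Function using (_∘_)
open import Relation.Nullary using (¬_; Dec; yes; no; does; contradiction)
open import Relation.Nullary.Decidable
  using (⌊_⌋; toWitness; fromWitness; toWitnessFalse; fromWitnessFalse; decidable-stable)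
open import Relation.Binary.PropositionalEquality
  using (_≡_; _≢_; refl; sym; trans; cong; cong₂; subst; module ≡-Reasoning)

open ≡-Reasoning

private
  variable
    A : Set
    m n : ℕ

∈-if⁻ : ∀ b {xs : List A} {x} → x ∈ₗ (if b then xs else []) → T b × x ∈ₗ xs
∈-if⁻ true x∈ = _ , x∈

∈-if⁺ : ∀ {b} {xs : List A} {x} → T b → x ∈ₗ xs → x ∈ₗ (if b then xs else [])
∈-if⁺ {b = true} _ x∈ = x∈

map≡[]⇒≡[] : ∀ {B : Set} (f : A → B) {xs} → map f xs ≡ [] → xs ≡ []
map≡[]⇒≡[] f {[]} _ = refl

T-not⇒¬T : ∀ {b} → T (not b) → ¬ T b
T-not⇒¬T {false} _ ()

¬T⇒T-not : ∀ {b} → ¬ T b → T (not b)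
¬T⇒T-not {false} _ = _
¬T⇒T-not {true} ¬t = ¬t _

insertAt-punchOut : ∀ (xs : Vec A n) {i j : Fin (suc n)} (v : A) (i≢j : i ≢ j) →
                    lookup (insertAt xs i v) j ≡ lookup xs (punchOut i≢j)
insertAt-punchOut xs {i} {j} v i≢j = begin
  lookup (insertAt xs i v) j                          ≡⟨ cong (lookup (insertAt xs i v)) (sym (punchIn-punchOut i≢j)) ⟩
  lookup (insertAt xs i v) (punchIn i (punchOut i≢j)) ≡⟨ insertAt-punchIn xs i v _ ⟩
  lookup xs (punchOut i≢j)                            ∎

lookup-removeAt : ∀ (xs : Vec A (suc n)) (i : Fin (suc n)) (j : Fin n) →
                  lookup (removeAt xs i) j ≡ lookup xs (punchIn i j)
lookup-removeAt xs i j = begin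
  lookup (removeAt xs i) j                                  ≡⟨ cong (lookup (removeAt xs i)) (sym (punchOut-punchIn i)) ⟩
  lookup (removeAt xs i) (punchOut (punchInᵢ≢i i j ∘ sym)) ≡⟨ removeAt-punchOut xs (punchInᵢ≢i i j ∘ sym) ⟩
  lookup xs (punchIn i j)                                   ∎

∈-removeAt⁻ : ∀ {p : Subset (suc n)} {i j} → j ∈ removeAt p i → punchIn i j ∈ p
∈-removeAt⁻ {p = p} {i} {j} j∈ = lookup⇒[]= _ p (trans (sym (lookup-removeAt p i j)) ([]=⇒lookup j∈))

∈-removeAt⁺ : ∀ {p : Subset (suc n)} {i j} → punchIn i j ∈ p → j ∈ removeAt p i
∈-removeAt⁺ {p = p} {i} {j} j∈ = lookup⇒[]= j _ (trans (lookup-removeAt p i j) ([]=⇒lookup j∈))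

∣removeAt∣≡∣p∣ : ∀ (p : Subset (suc n)) {i} → i ∉ p → ∣ removeAt p i ∣ ≡ ∣ p ∣
∣removeAt∣≡∣p∣ (true Vec.∷ p) {zero} i∉p = contradiction Vec.here i∉p
∣removeAt∣≡∣p∣ (false Vec.∷ p) {zero} _ = refl
∣removeAt∣≡∣p∣ (true Vec.∷ b Vec.∷ p) {suc i} i∉p = cong suc (∣removeAt∣≡∣p∣ (b Vec.∷ p) (i∉p ∘ Vec.there))
∣removeAt∣≡∣p∣ (false Vec.∷ b Vec.∷ p) {suc i} i∉p = ∣removeAt∣≡∣p∣ (b Vec.∷ p) (i∉p ∘ Vec.there)

infix 4 _⊨_ _⊨?_

_⊨_ : Assignment m → Clause m → Set
a ⊨ c = Any (a ∋ˡ_) c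

_⊨?_ : (a : Assignment m) (c : Clause m) → Dec (a ⊨ c)
a ⊨? c = Any.any? (λ l → lookup a (proj₁ l) Bool.≟ proj₂ l) c

Sat? : (φ : CNF m) (a : Assignment m) → Dec (Sat φ a)
Sat? φ a = All.all? (a ⊨?_) φ

∋-or-∋neg : ∀ (a : Assignment m) l → a ∋ˡ l ⊎ a ∋ˡ neg l
∋-or-∋neg a (x , s) with lookup a x Bool.≟ s
... | yes ax = inj₁ ax
... | no ax≢s = inj₂ (Bool.¬-not ax≢s)

∋⇒≢ : ∀ {a : Assignment m} {l x v} → a ∋ˡ l → lookup a x ≡ v → l ≢ (x , not v)
∋⇒≢ al ax refl = Bool.not-¬ ax al

∈⇒memb : ∀ {l : Lit m} {c} → l ∈ₗ c → T (memb l c)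
∈⇒memb l∈c = any⁺ _ (Any.map fromWitness l∈c)

memb⇒∈ : ∀ {l : Lit m} {c} → T (memb l c) → l ∈ₗ c
memb⇒∈ {c = c} t = Any.map toWitness (any⁻ _ c t)

taut⇒⊨ : ∀ {c : Clause m} → T (taut c) → ∀ a → a ⊨ c
taut⇒⊨ {c = c} t a with find (any⁻ _ c t)
... | l , l∈c , ¬l∈c with ∋-or-∋neg a l
...   | inj₁ al = lose l∈c al
...   | inj₂ a¬l = lose (memb⇒∈ ¬l∈c) a¬l

module _ {y : Fin m} {c : Clause m} where

  mentions⇒Any : T (mentions y c) → Any (λ l → proj₁ l ≡ y) c
  mentions⇒Any t = Any.map toWitness (any⁻ _ c t)

  ¬mentions⇒All : T (not (mentions y c)) → All (λ l → proj₁ l ≢ y) c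
  ¬mentions⇒All t = ¬Any⇒All¬ c (T-not⇒¬T t ∘ any⁺ _ ∘ Any.map fromWitness)

  All⇒¬mentions : All (λ l → proj₁ l ≢ y) c → T (not (mentions y c))
  All⇒¬mentions off = ¬T⇒T-not (All¬⇒¬Any off ∘ mentions⇒Any)

without : Lit m → Clause m → Clause m
without l₀ = filterᵇ (λ l → not ⌊ l ≟L l₀ ⌋)

∈-without⁺ : ∀ {l l₀ : Lit m} {c} → l ∈ₗ c → l ≢ l₀ → l ∈ₗ without l₀ c
∈-without⁺ {l₀ = l₀} l∈c l≢l₀ = ∈-filter⁺ (λ l → T? (not ⌊ l ≟L l₀ ⌋)) l∈c (fromWitnessFalse l≢l₀)

∈-without⁻ : ∀ {l l₀ : Lit m} {c} → l ∈ₗ without l₀ c → l ∈ₗ c × l ≢ l₀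
∈-without⁻ {l₀ = l₀} l∈ = let l∈c , l≢l₀ = ∈-filter⁻ (λ l → T? (not ⌊ l ≟L l₀ ⌋)) l∈ in l∈c , toWitnessFalse l≢l₀

resolve-⊨ : ∀ (y : Fin m) a {c d} → a ⊨ c → a ⊨ d → a ⊨ resolve y c d
resolve-⊨ y a {c} c⊨ d⊨ with lookup a y in ay
... | true  = let l , l∈d , al = find d⊨ in lose (∈-++⁺ʳ (without (y , true) c) (∈-without⁺ l∈d (∋⇒≢ {a = a} al ay))) al
... | false = let l , l∈c , al = find c⊨ in lose (∈-++⁺ˡ (∈-without⁺ l∈c (∋⇒≢ {a = a} al ay))) al

module _ (y : Fin m) {φ : CNF m} where

  private
    resolventsWith : Clause m → Clause m → CNF m
    resolventsWith c d = if memb (y , false) d then resolve y c d ∷ [] else []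

    resolventsOf : Clause m → CNF m
    resolventsOf c = if memb (y , true) c then concatMap (resolventsWith c) φ else []

  ∈-resolvents⁻ : ∀ {r} → r ∈ₗ resolvents y φ → ∃₂ λ c d → c ∈ₗ φ × d ∈ₗ φ × r ≡ resolve y c d
  ∈-resolvents⁻ r∈ with find (∈-concatMap⁻ resolventsOf r∈)
  ... | c , c∈ , r∈c with find (∈-concatMap⁻ (resolventsWith c) (proj₂ (∈-if⁻ (memb (y , true) c) r∈c)))
  ...   | d , d∈ , r∈d with ∈-if⁻ (memb (y , false) d) r∈d
  ...     | _ , here r≡ = c , d , c∈ , d∈ , r≡

  ∈-resolvents⁺ : ∀ {c d} → c ∈ₗ φ → d ∈ₗ φ → (y , true) ∈ₗ c → (y , false) ∈ₗ d →
                  resolve y c d ∈ₗ resolvents y φ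
  ∈-resolvents⁺ {c} {d} c∈ d∈ y∈c ¬y∈d =
    ∈-concatMap⁺ resolventsOf (lose c∈ (∈-if⁺ (∈⇒memb y∈c)
      (∈-concatMap⁺ (resolventsWith c) (lose d∈ (∈-if⁺ (∈⇒memb ¬y∈d) (here refl))))))

module Elimination {n} (y : Fin (suc n)) (φ : CNF (suc n)) where

  withResolvents : CNF (suc n)
  withResolvents = φ ++ filterᵇ (λ r → not (taut r)) (resolvents y φ)

  ∈-eliminate⁻ : ∀ {c'} → c' ∈ₗ eliminate y φ →
                 ∃[ c ] (c ∈ₗ withResolvents × T (not (mentions y c)) × c' ≡ mapMaybe (dropLit y) c)
  ∈-eliminate⁻ c'∈ with ∈-map⁻ _ c'∈
  ... | c , c∈ , c'≡ = let c∈R , off = ∈-filter⁻ (T? ∘ _) c∈ in c , c∈R , off , c'≡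

  ∈-eliminate⁺ : ∀ {c} → c ∈ₗ withResolvents → T (not (mentions y c)) →
                 mapMaybe (dropLit y) c ∈ₗ eliminate y φ
  ∈-eliminate⁺ c∈ off = ∈-map⁺ _ (∈-filter⁺ (T? ∘ _) c∈ off)

  drop-⊨ : ∀ a {c} → All (λ l → proj₁ l ≢ y) c → a ⊨ c → removeAt a y ⊨ mapMaybe (dropLit y) c
  drop-⊨ a {(x , _) ∷ c} (x≢y ∷ off) c⊨ with y ≟ᶠ x
  ... | yes y≡x = contradiction (sym y≡x) x≢y
  ... | no y≢x with c⊨
  ...   | here ax = here (trans (removeAt-punchOut a y≢x) ax)
  ...   | there c⊨ = there (drop-⊨ a off c⊨)

  lift-⊨ : ∀ b v c → b ⊨ mapMaybe (dropLit y) c → insertAt b y v ⊨ c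
  lift-⊨ b v ((x , _) ∷ c) c⊨ with y ≟ᶠ x
  ... | yes _ = there (lift-⊨ b v c c⊨)
  ... | no y≢x with c⊨
  ...   | here bx = here (trans (insertAt-punchOut b v y≢x) bx)
  ...   | there c⊨ = there (lift-⊨ b v c c⊨)

  withResolvents-⊨ : ∀ a {c} → Sat φ a → c ∈ₗ withResolvents → a ⊨ c
  withResolvents-⊨ a a⊨φ c∈ with ∈-++⁻ φ c∈
  ... | inj₁ c∈φ = All.lookup a⊨φ c∈φ
  ... | inj₂ c∈R with ∈-resolvents⁻ y (proj₁ (∈-filter⁻ (T? ∘ _) c∈R))
  ...   | c , d , c∈φ , d∈φ , refl = resolve-⊨ y a (All.lookup a⊨φ c∈φ) (All.lookup a⊨φ d∈φ)

  eliminate-sound : ∀ a → Sat φ a → Sat (eliminate y φ) (removeAt a y)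
  eliminate-sound a a⊨φ = All.tabulate λ c'∈ →
    let c , c∈ , off , c'≡ = ∈-eliminate⁻ c'∈ in
    subst (removeAt a y ⊨_) (sym c'≡) (drop-⊨ a (¬mentions⇒All off) (withResolvents-⊨ a a⊨φ c∈))

  insertAt-∋-irrelevant : ∀ b {l : Lit (suc n)} {v w} → proj₁ l ≢ y → insertAt b y v ∋ˡ l → insertAt b y w ∋ˡ l
  insertAt-∋-irrelevant b {v = v} {w} x≢y bv = begin
    lookup (insertAt b y w) _       ≡⟨ insertAt-punchOut b w (x≢y ∘ sym) ⟩
    lookup b (punchOut (x≢y ∘ sym)) ≡⟨ sym (insertAt-punchOut b v (x≢y ∘ sym)) ⟩
    lookup (insertAt b y v) _       ≡⟨ bv ⟩
    _                               ∎

  insertAt-∌⇒proj₁≢ : ∀ b {l : Lit (suc n)} {v} → l ≢ (y , v) → ¬ insertAt b y (not v) ∋ˡ l → proj₁ l ≢ y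
  insertAt-∌⇒proj₁≢ b {_ , s} {v} l≢ b∌l refl with s Bool.≟ v
  ... | yes refl = l≢ refl
  ... | no s≢v = b∌l (trans (insertAt-lookup b y (not v)) (sym (Bool.¬-not s≢v)))

  module _ {b} (b⊨ψ : Sat (eliminate y φ) b) where

    kept-⊨ : ∀ {c} → c ∈ₗ withResolvents → T (not (mentions y c)) → ∀ v → insertAt b y v ⊨ c
    kept-⊨ {c} c∈ off v = lift-⊨ b v c (All.lookup b⊨ψ (∈-eliminate⁺ c∈ off))

    falsified⇒∋ : ∀ {c v} → c ∈ₗ φ → ¬ insertAt b y v ⊨ c → (y , not v) ∈ₗ c
    falsified⇒∋ {c} {v} c∈ c✗ with T? (mentions y c)
    ... | no off = contradiction (kept-⊨ (∈-++⁺ˡ c∈) (¬T⇒T-not off) v) c✗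
    ... | yes on with find (mentions⇒Any on)
    ...   | (_ , s) , l∈c , refl = subst (λ s → (y , s) ∈ₗ c) (Bool.¬-not s≢v) l∈c
      where
      s≢v : s ≢ v
      s≢v refl = c✗ (lose l∈c (insertAt-lookup b y v))

    resolve-falsified : ∀ {c d} → ¬ insertAt b y false ⊨ c → ¬ insertAt b y true ⊨ d →
                        ∀ {l} → l ∈ₗ resolve y c d → proj₁ l ≢ y × ¬ insertAt b y false ∋ˡ l
    resolve-falsified {c} c✗ d✗ l∈ with ∈-++⁻ (without (y , true) c) l∈
    ... | inj₁ l∈c' = let l∈c , l≢ = ∈-without⁻ l∈c'
                          l✗ = c✗ ∘ lose l∈c
                      in insertAt-∌⇒proj₁≢ b l≢ l✗ , l✗
    ... | inj₂ l∈d' = let l∈d , l≢ = ∈-without⁻ l∈d'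
                          l✗ = d✗ ∘ lose l∈d
                          x≢y = insertAt-∌⇒proj₁≢ b l≢ l✗
                      in x≢y , l✗ ∘ insertAt-∋-irrelevant b x≢y

    -- The resolvent of c and d is false under insertAt b y false, yet it is a
    -- tautology or a clause kept (with y deleted) in ψ.
    no-opposite-falsified : ∀ {c d} → c ∈ₗ φ → d ∈ₗ φ →
                            ¬ insertAt b y false ⊨ c → ¬ insertAt b y true ⊨ d → ⊥
    no-opposite-falsified {c} {d} c∈ d∈ c✗ d✗ = r✗ r⊨
      where
      r✗ : ¬ insertAt b y false ⊨ resolve y c d
      r✗ r⊨ = let _ , l∈ , al = find r⊨ in proj₂ (resolve-falsified c✗ d✗ l∈) al

      r∈ : resolve y c d ∈ₗ resolvents y φ
      r∈ = ∈-resolvents⁺ y c∈ d∈ (falsified⇒∋ c∈ c✗) (falsified⇒∋ d∈ d✗)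

      r⊨ : insertAt b y false ⊨ resolve y c d
      r⊨ with T? (taut (resolve y c d))
      ... | yes t = taut⇒⊨ t (insertAt b y false)
      ... | no ¬t = kept-⊨ (∈-++⁺ʳ φ (∈-filter⁺ (T? ∘ _) r∈ (¬T⇒T-not ¬t)))
                           (All⇒¬mentions (All.tabulate (proj₁ ∘ resolve-falsified c✗ d✗))) false

    ¬Sat-true⇒Sat-false : ¬ Sat φ (insertAt b y true) → Sat φ (insertAt b y false)
    ¬Sat-true⇒Sat-false ✗ = All.tabulate λ {c} c∈ →
      let d , d∈ , d✗ = find (¬All⇒Any¬ (insertAt b y true ⊨?_) φ ✗) in
      decidable-stable (insertAt b y false ⊨? c) λ c✗ → no-opposite-falsified c∈ d∈ c✗ d✗

  extend : Assignment n → Assignment (suc n)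
  extend b = insertAt b y (does (Sat? φ (insertAt b y true)))

  extend-sound : ∀ b → Sat (eliminate y φ) b → Sat φ (extend b)
  extend-sound b b⊨ψ with Sat? φ (insertAt b y true)
  ... | yes ⊨φ = ⊨φ
  ... | no ✗ = ¬Sat-true⇒Sat-false b⊨ψ ✗

record SampleTransfer (Cₛ : Subset m) (φ : CNF m) (Cₜ : Subset n) (ψ : CNF n) : Set where
  field
    forth : Assignment m → Assignment n
    back : Assignment n → Assignment m
    forth-sound : ∀ {a} → Sat φ a → Sat ψ (forth a)
    back-sound : ∀ {b} → Sat ψ b → Sat φ (back b)
    ι : ∀ {x} → x ∈ Cₜ → Fin m
    ι-concrete : ∀ {x} (x∈ : x ∈ Cₜ) → ι x∈ ∈ Cₛ
    ι-injective : ∀ {x x'} (x∈ : x ∈ Cₜ) (x'∈ : x' ∈ Cₜ) → ι x∈ ≡ ι x'∈ → x ≡ x'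
    lookup-forth : ∀ a {x} (x∈ : x ∈ Cₜ) → lookup (forth a) x ≡ lookup a (ι x∈)
    lookup-back : ∀ b {x} (x∈ : x ∈ Cₜ) → lookup (back b) (ι x∈) ≡ lookup b x
    ∣Cₛ∣≡∣Cₜ∣ : ∣ Cₛ ∣ ≡ ∣ Cₜ ∣

module _ {Cₛ : Subset m} {φ : CNF m} {Cₜ : Subset n} {ψ : CNF n} (t : SampleTransfer Cₛ φ Cₜ ψ) where
  open SampleTransfer t

  module _ {x : Fin n} (x∈ : x ∈ Cₜ) {v : Bool} where

    back-∋ : ∀ b → b ∋ˡ (x , v) → back b ∋ˡ (ι x∈ , v)
    back-∋ b = trans (lookup-back b x∈)

    forth-∋ : ∀ a → a ∋ˡ (ι x∈ , v) → forth a ∋ˡ (x , v)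
    forth-∋ a = trans (lookup-forth a x∈)

    back-model : ∃[ b ] (Sat ψ b × b ∋ˡ (x , v)) → ∃[ a ] (Sat φ a × a ∋ˡ (ι x∈ , v))
    back-model (b , b⊨ , bx) = back b , back-sound b⊨ , back-∋ b bx

    forth-member : ∀ {S} → ∃[ a ] (a ∈ₗ S × a ∋ˡ (ι x∈ , v)) → ∃[ b ] (b ∈ₗ map forth S × b ∋ˡ (x , v))
    forth-member (a , a∈ , ax) = forth a , ∈-map⁺ forth a∈ , forth-∋ a ax

  module _ {x₁ x₂ : Fin n} (x₁∈ : x₁ ∈ Cₜ) (x₂∈ : x₂ ∈ Cₜ) {v₁ v₂ : Bool} where

    back-feasible : Feasible₂ ψ (x₁ , v₁) (x₂ , v₂) → Feasible₂ φ (ι x₁∈ , v₁) (ι x₂∈ , v₂)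
    back-feasible (b , b⊨ , bx₁ , bx₂) = back b , back-sound b⊨ , back-∋ x₁∈ b bx₁ , back-∋ x₂∈ b bx₂

    forth-covered : ∀ {S} → Covered₂ S (ι x₁∈ , v₁) (ι x₂∈ , v₂) → Covered₂ (map forth S) (x₁ , v₁) (x₂ , v₂)
    forth-covered (a , a∈ , ax₁ , ax₂) = forth a , ∈-map⁺ forth a∈ , forth-∋ x₁∈ a ax₁ , forth-∋ x₂∈ a ax₂

    ι-≢ : (x₁ , v₁) ≢ (x₂ , v₂) → (ι x₁∈ , v₁) ≢ (ι x₂∈ , v₂)
    ι-≢ l≢ e = l≢ (cong₂ _,_ (ι-injective x₁∈ x₂∈ (cong proj₁ e)) (cong proj₂ e))

  forth-coverage : ∀ {S} → PairwiseCoverage Cₛ φ S → PairwiseCoverage Cₜ ψ (map forth S)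
  forth-coverage {S} (pairs , nonempty , single) = pairs′ , nonempty′ , single′
    where
    pairs′ : ∀ l₁ l₂ → Concrete Cₜ l₁ → Concrete Cₜ l₂ → l₁ ≢ l₂ →
             Feasible₂ ψ l₁ l₂ → Covered₂ (map forth S) l₁ l₂
    pairs′ (x₁ , _) (x₂ , _) x₁∈ x₂∈ l≢ feasible = forth-covered x₁∈ x₂∈
      (pairs _ _ (ι-concrete x₁∈) (ι-concrete x₂∈) (ι-≢ x₁∈ x₂∈ l≢) (back-feasible x₁∈ x₂∈ feasible))
    nonempty′ : Satisfiable ψ → map forth S ≢ []
    nonempty′ (b , b⊨) = nonempty (back b , back-sound b⊨) ∘ map≡[]⇒≡[] forth
    single′ : ∣ Cₜ ∣ ≡ 1 → ∀ x → x ∈ Cₜ →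
              (∃[ b ] (Sat ψ b × b ∋ˡ (x , true))) → (∃[ b ] (Sat ψ b × b ∋ˡ (x , false))) →
              (∃[ a ] (a ∈ₗ map forth S × a ∋ˡ (x , true))) × (∃[ a ] (a ∈ₗ map forth S × a ∋ˡ (x , false)))
    single′ ∣Cₜ∣≡1 x x∈ pos neg =
      let pos′ , neg′ = single (trans ∣Cₛ∣≡∣Cₜ∣ ∣Cₜ∣≡1) (ι x∈) (ι-concrete x∈) (back-model x∈ pos) (back-model x∈ neg)
      in forth-member x∈ pos′ , forth-member x∈ neg′

  transfer : ∀ (S : List (Assignment m)) → IsSample φ S → PairwiseCoverage Cₛ φ S →
             ∃[ S' ] (IsSample ψ S' × PairwiseCoverage Cₜ ψ S' × length S' ≡ length S)
  transfer S S⊨ cov = map forth S , map⁺ (All.map forth-sound S⊨) , forth-coverage cov , length-map forth S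

module _ {n} (φ : CNF (suc n)) (C : Subset (suc n)) {y : Fin (suc n)} (y∉C : y ∉ C) where
  open Elimination y φ

  private
    y≢ : ∀ {x} → x ∈ C → y ≢ x
    y≢ x∈ refl = y∉C x∈

  eliminate-forward : SampleTransfer C φ (removeAt C y) (eliminate y φ)
  eliminate-forward = record
    { forth = λ a → removeAt a y
    ; back = extend
    ; forth-sound = λ {a} → eliminate-sound a
    ; back-sound = λ {b} → extend-sound b
    ; ι = λ {x} _ → punchIn y x
    ; ι-concrete = ∈-removeAt⁻
    ; ι-injective = λ {x} {x'} _ _ → punchIn-injective y x x'
    ; lookup-forth = λ a {x} _ → lookup-removeAt a y x
    ; lookup-back = λ b {x} _ → insertAt-punchIn b y _ x
    ; ∣Cₛ∣≡∣Cₜ∣ = sym (∣removeAt∣≡∣p∣ C y∉C)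
    }

  eliminate-backward : SampleTransfer (removeAt C y) (eliminate y φ) C φ
  eliminate-backward = record
    { forth = extend
    ; back = λ a → removeAt a y
    ; forth-sound = λ {b} → extend-sound b
    ; back-sound = λ {a} → eliminate-sound a
    ; ι = λ x∈ → punchOut (y≢ x∈)
    ; ι-concrete = λ x∈ → ∈-removeAt⁺ (subst (_∈ C) (sym (punchIn-punchOut (y≢ x∈))) x∈)
    ; ι-injective = λ x∈ x'∈ → punchOut-injective (y≢ x∈) (y≢ x'∈)
    ; lookup-forth = λ b x∈ → insertAt-punchOut b _ (y≢ x∈)
    ; lookup-back = λ a x∈ → removeAt-punchOut a (y≢ x∈)
    ; ∣Cₛ∣≡∣Cₜ∣ = ∣removeAt∣≡∣p∣ C y∉C
    }

theoremC2 : ∀ {n} (φ : CNF (suc n)) (C : Subset (suc n)) (y : Fin (suc n)) → y ∉ C →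
    (∀ (S : List (Assignment (suc n))) → IsSample φ S → PairwiseCoverage C φ S →
      ∃[ S' ] (IsSample (eliminate y φ) S' × PairwiseCoverage (removeAt C y) (eliminate y φ) S'
               × length S' ≡ length S))
    × (∀ (S : List (Assignment n)) → IsSample (eliminate y φ) S → PairwiseCoverage (removeAt C y) (eliminate y φ) S →
      ∃[ S' ] (IsSample φ S' × PairwiseCoverage C φ S' × length S' ≡ length S))
theoremC2 φ C y y∉C = transfer (eliminate-forward φ C y∉C) , transfer (eliminate-backward φ C y∉C)
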